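{- Let $k$ be an integer with $1\leq k\leq 7$, and let $\alpha,\beta,s$ be positive integers with $\alpha<2^{s}$. Put $n=\alpha+\beta\cdot 2^{s+1}$. Then \[ |H_{k}^{\nabla n}|=|H_{k}^{\nabla\alpha}|\cdot|H_{k}^{\nabla\beta}|. \]
   Context: Here $\mathbb{N}=\{1,2,3,\ldots\}$. For nonempty finite sets $C=\{c_1,\ldots,c_s\}$ and $D=\{d_1,\ldots,d_t\}$ of positive integers, the symmetric product is $C\mathbin{\nabla}D=c_1D\mathbin{\triangle}c_2D\mathbin{\triangle}\cdots\mathbin{\triangle}c_sD$, where $c_iD=\{c_id_1,\ldots,c_id_t\}$ and $\triangle$ is symmetric difference. Equivalently, $C\mathbin{\nabla}D$ is the set of integers $m$ for which the number of pairs $(c,d)\in C\times D$ with $cd=m$ is odd. If $C$ or $D$ is empty, $C\mathbin{\nabla}D=\varnothing$. For $k\in\mathbb{N}$ let $H_k=\{1,2,\ldots,k\}$, $H_k^{\nabla 0}=\{1\}$ and $H_k^{\nabla n}=H_k^{\nabla(n-1)}\mathbin{\nabla}H_k$ for $n\geq1$ (the $n$-th symmetric power of $H_k$). -}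

module Defs where

open import Data.Bool using (Bool; true; false; if_then_else_)
open import Data.Nat using (ℕ; zero; suc; _*_; _≡ᵇ_; _%_)
open import Data.Nat.Properties using (_≟_)
open import Data.List using (List; []; _∷_; map; concatMap; filterᵇ; deduplicate; length)

-- Finite sets of positive integers are represented by duplicate-free lists.

products : List ℕ → List ℕ → List ℕ
products C D = concatMap (λ c → map (c *_) D) C

count : ℕ → List ℕ → ℕ
count m []       = 0
count m (x ∷ xs) = if m ≡ᵇ x then suc (count m xs) else count m xs

isOdd : ℕ → Bool
isOdd n = (n % 2) ≡ᵇ 1

_∇_ : List ℕ → List ℕ → List ℕ
C ∇ D = filterᵇ (λ m → isOdd (count m (products C D)))
                (deduplicate _≟_ (products C D))

H : ℕ → List ℕ
H zero    = []
H (suc k) = H k Data.List.++ (suc k ∷ [])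

_∇^_ : List ℕ → ℕ → List ℕ
A ∇^ zero  = 1 ∷ []
A ∇^ suc n = (A ∇^ n) ∇ A

∣_∣ : List ℕ → ℕ
∣ A ∣ = length A

-- Read a list of positive integers as an element of the monoid algebra 𝔽₂[(ℕ, ·)] by counting
-- multiplicities mod 2.  The symmetric product C ∇ D is then the product CD of the algebra (pairs of
-- equal products cancel), so H^∇n is the n-th power of H.  In characteristic 2 squaring is additive,
-- hence H^(β·2^j) is H^β with every element raised to the power 2^j, and
--   H^∇(α + β·N) = H^∇α · (H^∇β)^[N],   N = 2^(s+1).
-- For k ≤ 7 every element of H^∇α is 2^a 3^b 5^c 7^d with exponents ≤ 2α < N, so the exponents of
-- a·b^N are base-N numerals whose digits recover a and b.  Hence the products a·b^N are pairwise
-- distinct, nothing cancels, and |H^∇n| = |H^∇α|·|H^∇β|.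
module Submission where

open import Defs
open import Data.Bool.Base using (true; false; T; if_then_else_)
open import Data.List.Base
  using (List; []; _∷_; [_]; _++_; map; concatMap; filter; deduplicate; length; cartesianProductWith)
open import Data.List.Membership.Propositional using (_∈_; _∉_; find)
open import Data.List.Membership.Propositional.Properties
  using (∈-++⁺ˡ; ∈-++⁺ʳ; ∈-++⁻; ∈-map⁻; ∈-concatMap⁻; ∈-filter⁺; ∈-filter⁻; ∈-deduplicate⁺;
         ∈-deduplicate⁻; ∈-cartesianProductWith⁻)
open import Data.List.Membership.Propositional.Properties.WithK using (unique∧set⇒bag)
open import Data.List.Properties
  using (map-++; map-cong; map-∘; map-id; length-++; length-map; concatMap-++; concatMap-map;
         concatMap-pure; filter-accept; filter-reject)
open import Data.List.Relation.Binary.BagAndSetEquality using (∼bag⇒↭)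
open import Data.List.Relation.Binary.Disjoint.Propositional using (Disjoint)
open import Data.List.Relation.Binary.Permutation.Propositional.Properties using (↭-length)
open import Data.List.Relation.Unary.All as All using (All; []; _∷_)
import Data.List.Relation.Unary.All.Properties as All
open import Data.List.Relation.Unary.Any using (here; there)
open import Data.List.Relation.Unary.Unique.Propositional using (Unique; []; _∷_)
import Data.List.Relation.Unary.Unique.Propositional.Properties as Unique
open import Data.Nat.Base
  using (ℕ; zero; suc; _+_; _*_; _^_; _≤_; _<_; _≡ᵇ_; _%_; z≤n; s≤s; parity)
open import Data.Nat.Divisibility using (_∣_; _∣?_; divides; ∣1⇒≡1)
open import Data.Nat.DivMod using ([m+n]%n≡m%n; [m+kn]%n≡m%n; m<n⇒m%n≡m)
open import Data.Nat.ListAction using (sum)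
open import Data.Nat.Primality using (Prime; prime?; ¬prime[1]; euclidsLemma; prime⇒nonZero)
open import Data.Nat.Properties
open import Data.List.Relation.Unary.Unique.DecPropositional.Properties _≟_ using (deduplicate-!)
open import Data.Parity.Base as ℙ using (Parity; 0ℙ; 1ℙ)
import Data.Parity.Properties as ℙ
open import Data.Product using (∃; ∃₂; _×_; _,_; proj₁; proj₂)
open import Data.Sum using (inj₁; inj₂; [_,_]′)
open import Data.Unit using (tt)
open import Data.Vec.Base as Vec using (Vec; []; _∷_)
import Data.Vec.Properties as Vec
open import Data.Vec.Relation.Unary.All as VecAll using ([]; _∷_)
open import Data.Vec.Relation.Unary.AllPairs using (AllPairs; []; _∷_; allPairs?)
open import Function using (_∘_; id)
open import Function.Bundles using (mk⇔)
open import Relation.Binary.Bundles using (Setoid)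
import Relation.Binary.Reasoning.Setoid as SetoidReasoning
open import Relation.Binary.PropositionalEquality hiding ([_])
open import Relation.Nullary using (¬_; ¬?; yes; no; contradiction)
open import Relation.Nullary.Decidable using (T?; True; toWitness; from-yes)
open import Relation.Unary using (Decidable)

import Algebra.Properties.CommutativeSemigroup as CommutativeSemigroupProperties
open CommutativeSemigroupProperties +-commutativeSemigroup
  using () renaming (x∙yz≈y∙xz to m+[n+o]≡n+[m+o])
open CommutativeSemigroupProperties ℙ.+-commutativeSemigroup
  using () renaming (x∙yz≈y∙xz to p+[q+r]≡q+[p+r])

count-++ : ∀ m xs ys → count m (xs ++ ys) ≡ count m xs + count m ys
count-++ m []       ys = refl
count-++ m (x ∷ xs) ys with m ≡ᵇ x
... | true  = cong suc (count-++ m xs ys)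
... | false = count-++ m xs ys

count-head : ∀ m xs → count m (m ∷ xs) ≡ suc (count m xs)
count-head m xs with m ≡ᵇ m | ≡⇒≡ᵇ m m refl
... | true  | _ = refl
... | false | ()

count-tail : ∀ {m x} xs → m ≢ x → count m (x ∷ xs) ≡ count m xs
count-tail {m} {x} xs m≢x with m ≡ᵇ x | ≡ᵇ⇒≡ m x
... | false | _   = refl
... | true  | m≡x = contradiction (m≡x tt) m≢x

∉⇒count≡0 : ∀ {m} xs → m ∉ xs → count m xs ≡ 0
∉⇒count≡0 []       _  = refl
∉⇒count≡0 (x ∷ xs) m∉ = trans (count-tail xs (m∉ ∘ here)) (∉⇒count≡0 xs (m∉ ∘ there))

count≢0⇒∈ : ∀ {m} xs → count m xs ≢ 0 → m ∈ xs
count≢0⇒∈     []       c≢0 = contradiction refl c≢0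
count≢0⇒∈ {m} (x ∷ xs) c≢0 with m ≟ x
... | yes refl = here refl
... | no  m≢x  = there (count≢0⇒∈ xs (c≢0 ∘ trans (count-tail xs m≢x)))

∈⇒count≡1 : ∀ {m xs} → Unique xs → m ∈ xs → count m xs ≡ 1
∈⇒count≡1 {xs = x ∷ xs} xs!@(_ ∷ _) (here refl) =
  trans (count-head x xs) (cong suc (∉⇒count≡0 xs (Unique.Unique[x∷xs]⇒x∉xs xs!)))
∈⇒count≡1 {xs = _ ∷ xs} (x≢xs ∷ xs!) (there m∈xs) =
  trans (count-tail xs (λ m≡x → All.lookup x≢xs m∈xs (sym m≡x))) (∈⇒count≡1 xs! m∈xs)

count-concatMap : ∀ m (F : ℕ → List ℕ) xs → count m (concatMap F xs) ≡ sum (map (count m ∘ F) xs)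
count-concatMap m F []       = refl
count-concatMap m F (x ∷ xs) =
  trans (count-++ m (F x) (concatMap F xs)) (cong (count m (F x) +_) (count-concatMap m F xs))

-- Multisets modulo 2

χ : List ℕ → ℕ → Parity
χ xs m = parity (count m xs)

χ≡1ℙ⇒∈ : ∀ {m} xs → χ xs m ≡ 1ℙ → m ∈ xs
χ≡1ℙ⇒∈ xs χ≡1ℙ = count≢0⇒∈ xs λ count≡0 → contradiction (trans (cong parity (sym count≡0)) χ≡1ℙ) λ ()

χ-++ : ∀ xs ys m → χ (xs ++ ys) m ≡ χ xs m ℙ.+ χ ys m
χ-++ xs ys m = trans (cong parity (count-++ m xs ys)) (ℙ.+-homo-+ (count m xs) (count m ys))

χ-++-++ : ∀ xs ys zs m → χ (xs ++ (ys ++ zs)) m ≡ χ xs m ℙ.+ (χ ys m ℙ.+ χ zs m)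
χ-++-++ xs ys zs m = trans (χ-++ xs (ys ++ zs) m) (cong (χ xs m ℙ.+_) (χ-++ ys zs m))

infix 4 _≈₂_
record _≈₂_ (xs ys : List ℕ) : Set where
  constructor mk≈₂
  field χ-≡ : ∀ m → χ xs m ≡ χ ys m
open _≈₂_

≈₂-refl : ∀ {xs} → xs ≈₂ xs
≈₂-refl = mk≈₂ λ _ → refl

≈₂-sym : ∀ {xs ys} → xs ≈₂ ys → ys ≈₂ xs
≈₂-sym xs≈ys = mk≈₂ λ m → sym (χ-≡ xs≈ys m)

≈₂-trans : ∀ {xs ys zs} → xs ≈₂ ys → ys ≈₂ zs → xs ≈₂ zs
≈₂-trans xs≈ys ys≈zs = mk≈₂ λ m → trans (χ-≡ xs≈ys m) (χ-≡ ys≈zs m)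

≈₂-setoid : Setoid _ _
≈₂-setoid = record
  { Carrier       = List ℕ
  ; _≈_           = _≈₂_
  ; isEquivalence = record { refl = ≈₂-refl ; sym = ≈₂-sym ; trans = ≈₂-trans }
  }

module ≈₂-Reasoning = SetoidReasoning ≈₂-setoid

++-≈₂ : ∀ {xs xs′ ys ys′} → xs ≈₂ xs′ → ys ≈₂ ys′ → xs ++ ys ≈₂ xs′ ++ ys′
++-≈₂ {xs} {xs′} {ys} {ys′} xs≈xs′ ys≈ys′ = mk≈₂ λ m → begin
  χ (xs ++ ys) m        ≡⟨ χ-++ xs ys m ⟩
  χ xs m ℙ.+ χ ys m     ≡⟨ cong₂ ℙ._+_ (χ-≡ xs≈xs′ m) (χ-≡ ys≈ys′ m) ⟩
  χ xs′ m ℙ.+ χ ys′ m   ≡⟨ χ-++ xs′ ys′ m ⟨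
  χ (xs′ ++ ys′) m      ∎
  where open ≡-Reasoning

++-≈₂ʳ : ∀ xs {ys zs} → ys ≈₂ zs → xs ++ ys ≈₂ xs ++ zs
++-≈₂ʳ xs = ++-≈₂ (≈₂-refl {xs})

∷-≈₂ : ∀ x {ys zs} → ys ≈₂ zs → x ∷ ys ≈₂ x ∷ zs
∷-≈₂ x = ++-≈₂ʳ [ x ]

++-swap-≈₂ : ∀ xs ys zs → xs ++ (ys ++ zs) ≈₂ ys ++ (xs ++ zs)
++-swap-≈₂ xs ys zs = mk≈₂ λ m → begin
  χ (xs ++ (ys ++ zs)) m            ≡⟨ χ-++-++ xs ys zs m ⟩
  χ xs m ℙ.+ (χ ys m ℙ.+ χ zs m)    ≡⟨ p+[q+r]≡q+[p+r] (χ xs m) (χ ys m) (χ zs m) ⟩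
  χ ys m ℙ.+ (χ xs m ℙ.+ χ zs m)    ≡⟨ χ-++-++ ys xs zs m ⟨
  χ (ys ++ (xs ++ zs)) m            ∎
  where open ≡-Reasoning

++-cancel-≈₂ : ∀ xs ys → xs ++ (xs ++ ys) ≈₂ ys
++-cancel-≈₂ xs ys = mk≈₂ λ m → begin
  χ (xs ++ (xs ++ ys)) m            ≡⟨ χ-++-++ xs xs ys m ⟩
  χ xs m ℙ.+ (χ xs m ℙ.+ χ ys m)    ≡⟨ ℙ.+-assoc (χ xs m) (χ xs m) (χ ys m) ⟨
  (χ xs m ℙ.+ χ xs m) ℙ.+ χ ys m    ≡⟨ cong (ℙ._+ χ ys m) (ℙ.p+p≡0ℙ (χ xs m)) ⟩
  χ ys m                            ∎
  where open ≡-Reasoning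

_without_ : List ℕ → ℕ → List ℕ
xs without u = filter (¬? ∘ (u ≟_)) xs

without-head : ∀ u xs → (u ∷ xs) without u ≡ xs without u
without-head u xs = filter-reject (¬? ∘ (u ≟_)) λ u≢u → u≢u refl

without-∷ : ∀ {u x} xs → u ≢ x → (x ∷ xs) without u ≡ x ∷ (xs without u)
without-∷ {u} xs u≢x = filter-accept (¬? ∘ (u ≟_)) u≢x

count-without-self : ∀ u xs → count u (xs without u) ≡ 0
count-without-self u xs =
  ∉⇒count≡0 (xs without u) λ u∈ → proj₂ (∈-filter⁻ (¬? ∘ (u ≟_)) {xs = xs} u∈) refl

count-without : ∀ {m u} xs → m ≢ u → count m (xs without u) ≡ count m xs
count-without [] _ = refl
count-without {m} {u} (x ∷ xs) m≢u with u ≟ x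
... | yes refl = begin
  count m ((u ∷ xs) without u)             ≡⟨ cong (count m) (without-head u xs) ⟩
  count m (xs without u)                   ≡⟨ count-without xs m≢u ⟩
  count m xs                               ≡⟨ count-tail xs m≢u ⟨
  count m (u ∷ xs)                         ∎
  where open ≡-Reasoning
... | no u≢x = begin
  count m ((x ∷ xs) without u)             ≡⟨ cong (count m) (without-∷ xs u≢x) ⟩
  count m (x ∷ (xs without u))             ≡⟨ count-++ m [ x ] (xs without u) ⟩
  count m [ x ] + count m (xs without u)   ≡⟨ cong (count m [ x ] +_) (count-without xs m≢u) ⟩
  count m [ x ] + count m xs               ≡⟨ count-++ m [ x ] xs ⟨
  count m (x ∷ xs)                         ∎
  where open ≡-Reasoning

without-⊆ : ∀ {u us} xs → All (_∈ u ∷ us) xs → All (_∈ us) (xs without u)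
without-⊆ {u} xs xs⊆ = All.tabulate λ x∈ →
  let x∈xs , u≢x = ∈-filter⁻ (¬? ∘ (u ≟_)) x∈ in drop-head (All.lookup xs⊆ x∈xs) u≢x
  where
  drop-head : ∀ {x us} → x ∈ u ∷ us → u ≢ x → x ∈ us
  drop-head (here x≡u) u≢x = contradiction (sym x≡u) u≢x
  drop-head (there x∈) _   = x∈

without-≈₂ : ∀ {u} xs ys → xs ≈₂ ys → xs without u ≈₂ ys without u
without-≈₂ {u} xs ys xs≈ys = mk≈₂ χ-without
  where
  χ-without : ∀ m → χ (xs without u) m ≡ χ (ys without u) m
  χ-without m with m ≟ u
  ... | yes refl = cong parity (trans (count-without-self m xs) (sym (count-without-self m ys)))
  ... | no  m≢u  = begin
    χ (xs without u) m   ≡⟨ cong parity (count-without xs m≢u) ⟩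
    χ xs m               ≡⟨ χ-≡ xs≈ys m ⟩
    χ ys m               ≡⟨ cong parity (count-without ys m≢u) ⟨
    χ (ys without u) m   ∎
    where open ≡-Reasoning

sum-map-without : ∀ (g : ℕ → ℕ) u xs →
                  sum (map g xs) ≡ count u xs * g u + sum (map g (xs without u))
sum-map-without g u []       = refl
sum-map-without g u (x ∷ xs) with u ≟ x
... | yes refl = begin
  g u + sum (map g xs)                                      ≡⟨ cong (g u +_) (sum-map-without g u xs) ⟩
  g u + (count u xs * g u + sum (map g (xs without u)))     ≡⟨ +-assoc (g u) _ _ ⟨
  suc (count u xs) * g u + sum (map g (xs without u))       ≡⟨ cong₂ (λ c ys → c * g u + sum (map g ys))
                                                                 (count-head u xs) (without-head u xs) ⟨
  count u (u ∷ xs) * g u + sum (map g ((u ∷ xs) without u)) ∎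
  where open ≡-Reasoning
... | no u≢x = begin
  g x + sum (map g xs)                                      ≡⟨ cong (g x +_) (sum-map-without g u xs) ⟩
  g x + (count u xs * g u + sum (map g (xs without u)))     ≡⟨ m+[n+o]≡n+[m+o] (g x) (count u xs * g u) _ ⟩
  count u xs * g u + (g x + sum (map g (xs without u)))     ≡⟨ cong₂ (λ c ys → c * g u + sum (map g ys))
                                                                 (count-tail xs u≢x) (without-∷ xs u≢x) ⟨
  count u (x ∷ xs) * g u + sum (map g ((x ∷ xs) without u)) ∎
  where open ≡-Reasoning

parity-sum-map-without : ∀ (g : ℕ → ℕ) u xs →
  parity (sum (map g xs)) ≡ χ xs u ℙ.* parity (g u) ℙ.+ parity (sum (map g (xs without u)))
parity-sum-map-without g u xs = begin
  parity (sum (map g xs))                      ≡⟨ cong parity (sum-map-without g u xs) ⟩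
  parity (count u xs * g u + rest)             ≡⟨ ℙ.+-homo-+ (count u xs * g u) rest ⟩
  parity (count u xs * g u) ℙ.+ parity rest    ≡⟨ cong (ℙ._+ parity rest) (ℙ.*-homo-* (count u xs) (g u)) ⟩
  χ xs u ℙ.* parity (g u) ℙ.+ parity rest      ∎
  where
  open ≡-Reasoning
  rest = sum (map g (xs without u))

parity-sum-≈₂ : ∀ (g : ℕ → ℕ) {xs ys} → xs ≈₂ ys → parity (sum (map g xs)) ≡ parity (sum (map g ys))
parity-sum-≈₂ g {xs} {ys} = within (xs ++ ys) {xs} {ys} (All.tabulate ∈-++⁺ˡ) (All.tabulate (∈-++⁺ʳ xs))
  where
  -- Induction on a list us containing every element: split off all copies of its head at once.
  within : ∀ us {xs ys} → All (_∈ us) xs → All (_∈ us) ys → xs ≈₂ ys →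
           parity (sum (map g xs)) ≡ parity (sum (map g ys))
  within []       []       []       _ = refl
  within []       (() ∷ _) _        _
  within []       _        (() ∷ _) _
  within (u ∷ us) {xs} {ys} xs⊆ ys⊆ xs≈ys = begin
    parity (sum (map g xs))
      ≡⟨ parity-sum-map-without g u xs ⟩
    χ xs u ℙ.* parity (g u) ℙ.+ parity (sum (map g (xs without u)))
      ≡⟨ cong₂ (λ p q → p ℙ.* parity (g u) ℙ.+ q) (χ-≡ xs≈ys u) rest≡ ⟩
    χ ys u ℙ.* parity (g u) ℙ.+ parity (sum (map g (ys without u)))
      ≡⟨ parity-sum-map-without g u ys ⟨
    parity (sum (map g ys))
      ∎
    where
    open ≡-Reasoning
    rest≡ = within us (without-⊆ xs xs⊆) (without-⊆ ys ys⊆) (without-≈₂ xs ys xs≈ys)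

concatMap-≈₂ˡ : ∀ (F : ℕ → List ℕ) {xs ys} → xs ≈₂ ys → concatMap F xs ≈₂ concatMap F ys
concatMap-≈₂ˡ F {xs} {ys} xs≈ys = mk≈₂ λ m → begin
  χ (concatMap F xs) m                  ≡⟨ cong parity (count-concatMap m F xs) ⟩
  parity (sum (map (count m ∘ F) xs))   ≡⟨ parity-sum-≈₂ (count m ∘ F) xs≈ys ⟩
  parity (sum (map (count m ∘ F) ys))   ≡⟨ cong parity (count-concatMap m F ys) ⟨
  χ (concatMap F ys) m                  ∎
  where open ≡-Reasoning

concatMap-≈₂ʳ : ∀ {F G : ℕ → List ℕ} → (∀ x → F x ≈₂ G x) → ∀ xs → concatMap F xs ≈₂ concatMap G xs
concatMap-≈₂ʳ F≈G []       = ≈₂-refl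
concatMap-≈₂ʳ F≈G (x ∷ xs) = ++-≈₂ (F≈G x) (concatMap-≈₂ʳ F≈G xs)

map-≈₂ : ∀ (f : ℕ → ℕ) {xs ys} → xs ≈₂ ys → map f xs ≈₂ map f ys
map-≈₂ f {xs} {ys} xs≈ys = begin
  map f xs                 ≡⟨ map≡concatMap xs ⟩
  concatMap ([_] ∘ f) xs   ≈⟨ concatMap-≈₂ˡ ([_] ∘ f) xs≈ys ⟩
  concatMap ([_] ∘ f) ys   ≡⟨ map≡concatMap ys ⟨
  map f ys                 ∎
  where
  open ≈₂-Reasoning
  map≡concatMap : ∀ zs → map f zs ≡ concatMap ([_] ∘ f) zs
  map≡concatMap zs = trans (sym (concatMap-pure (map f zs))) (concatMap-map [_] f zs)

products-≈₂ˡ : ∀ {xs ys} zs → xs ≈₂ ys → products xs zs ≈₂ products ys zs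
products-≈₂ˡ zs = concatMap-≈₂ˡ (λ x → map (x *_) zs)

products-≈₂ʳ : ∀ xs {ys zs} → ys ≈₂ zs → products xs ys ≈₂ products xs zs
products-≈₂ʳ xs ys≈zs = concatMap-≈₂ʳ (λ x → map-≈₂ (x *_) ys≈zs) xs

products-identityʳ : ∀ xs → products xs [ 1 ] ≡ xs
products-identityʳ []       = refl
products-identityʳ (x ∷ xs) = cong₂ _∷_ (*-identityʳ x) (products-identityʳ xs)

products-map-*ˡ : ∀ a xs ys → products (map (a *_) xs) ys ≡ map (a *_) (products xs ys)
products-map-*ˡ a []       ys = refl
products-map-*ˡ a (x ∷ xs) ys = begin
  map (a * x *_) ys ++ products (map (a *_) xs) ys
    ≡⟨ cong₂ _++_ (trans (map-cong (*-assoc a x) ys) (map-∘ ys)) (products-map-*ˡ a xs ys) ⟩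
  map (a *_) (map (x *_) ys) ++ map (a *_) (products xs ys)
    ≡⟨ map-++ (a *_) (map (x *_) ys) (products xs ys) ⟨
  map (a *_) (products (x ∷ xs) ys)
    ∎
  where open ≡-Reasoning

products-assoc : ∀ xs ys zs → products (products xs ys) zs ≡ products xs (products ys zs)
products-assoc []       ys zs = refl
products-assoc (x ∷ xs) ys zs = begin
  products (map (x *_) ys ++ products xs ys) zs
    ≡⟨ concatMap-++ _ (map (x *_) ys) (products xs ys) ⟩
  products (map (x *_) ys) zs ++ products (products xs ys) zs
    ≡⟨ cong₂ _++_ (products-map-*ˡ x ys zs) (products-assoc xs ys zs) ⟩
  map (x *_) (products ys zs) ++ products xs (products ys zs)
    ∎
  where open ≡-Reasoning

products-∷ʳ-≈₂ : ∀ xs y ys → products xs (y ∷ ys) ≈₂ map (_* y) xs ++ products xs ys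
products-∷ʳ-≈₂ []       y ys = ≈₂-refl
products-∷ʳ-≈₂ (x ∷ xs) y ys = begin
  x * y ∷ (map (x *_) ys ++ products xs (y ∷ ys))
    ≈⟨ ∷-≈₂ (x * y) (++-≈₂ʳ (map (x *_) ys) (products-∷ʳ-≈₂ xs y ys)) ⟩
  x * y ∷ (map (x *_) ys ++ (map (_* y) xs ++ products xs ys))
    ≈⟨ ∷-≈₂ (x * y) (++-swap-≈₂ (map (x *_) ys) (map (_* y) xs) (products xs ys)) ⟩
  x * y ∷ (map (_* y) xs ++ (map (x *_) ys ++ products xs ys))
    ∎
  where open ≈₂-Reasoning

-- Frobenius: (x + X)² = x² + 2xX + X², and 2xX vanishes mod 2.
products-self-≈₂ : ∀ xs → products xs xs ≈₂ map (λ x → x * x) xs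
products-self-≈₂ []       = ≈₂-refl
products-self-≈₂ (x ∷ xs) = begin
  x * x ∷ (map (x *_) xs ++ products xs (x ∷ xs))
    ≈⟨ ∷-≈₂ (x * x) (++-≈₂ʳ (map (x *_) xs) (products-∷ʳ-≈₂ xs x xs)) ⟩
  x * x ∷ (map (x *_) xs ++ (map (_* x) xs ++ products xs xs))
    ≡⟨ cong (λ ys → x * x ∷ (map (x *_) xs ++ (ys ++ products xs xs))) (map-cong (λ y → *-comm y x) xs) ⟩
  x * x ∷ (map (x *_) xs ++ (map (x *_) xs ++ products xs xs))
    ≈⟨ ∷-≈₂ (x * x) (++-cancel-≈₂ (map (x *_) xs) (products xs xs)) ⟩
  x * x ∷ products xs xs
    ≈⟨ ∷-≈₂ (x * x) (products-self-≈₂ xs) ⟩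
  x * x ∷ map (λ x → x * x) xs
    ∎
  where open ≈₂-Reasoning

products-map≡cartesianProductWith : ∀ (g : ℕ → ℕ) xs ys →
  products xs (map g ys) ≡ cartesianProductWith (λ x y → x * g y) xs ys
products-map≡cartesianProductWith g []       ys = refl
products-map≡cartesianProductWith g (x ∷ xs) ys =
  cong₂ _++_ (sym (map-∘ ys)) (products-map≡cartesianProductWith g xs ys)

∈-products⁻ : ∀ {m} xs ys → m ∈ products xs ys → ∃₂ λ x y → x ∈ xs × y ∈ ys × m ≡ x * y
∈-products⁻ xs ys m∈ with find (∈-concatMap⁻ (λ x → map (x *_) ys) {xs = xs} m∈)
... | x , x∈ , m∈map with ∈-map⁻ (x *_) m∈map
...   | y , y∈ , refl = x , y , x∈ , y∈ , refl

unique-≈₂⇒⊆ : ∀ {xs ys m} → Unique xs → xs ≈₂ ys → m ∈ xs → m ∈ ys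
unique-≈₂⇒⊆ {xs} {ys} {m} xs! xs≈ys m∈xs =
  χ≡1ℙ⇒∈ ys (trans (sym (χ-≡ xs≈ys m)) (cong parity (∈⇒count≡1 xs! m∈xs)))

unique-≈₂⇒length≡ : ∀ {xs ys} → Unique xs → Unique ys → xs ≈₂ ys → length xs ≡ length ys
unique-≈₂⇒length≡ xs! ys! xs≈ys = ↭-length (∼bag⇒↭ (unique∧set⇒bag xs! ys!
  (mk⇔ (unique-≈₂⇒⊆ xs! xs≈ys) (unique-≈₂⇒⊆ ys! (≈₂-sym xs≈ys)))))

map-unique : ∀ {A B : Set} {f : A → B} {xs} → (∀ {x y} → x ∈ xs → y ∈ xs → f x ≡ f y → x ≡ y) →
             Unique xs → Unique (map f xs)
map-unique {xs = []}     _   []           = []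
map-unique {xs = x ∷ xs} inj (x≢xs ∷ xs!) =
  All.map⁺ (All.tabulate λ y∈ fx≡fy → All.lookup x≢xs y∈ (inj (here refl) (there y∈) fx≡fy))
  ∷ map-unique (λ x∈ y∈ → inj (there x∈) (there y∈)) xs!

module _ {A B C : Set} where

  cartesianProductWith-unique :
    ∀ (f : A → B → C) {xs ys} →
    (∀ {w x y z} → w ∈ xs → x ∈ xs → y ∈ ys → z ∈ ys → f w y ≡ f x z → w ≡ x × y ≡ z) →
    Unique xs → Unique ys → Unique (cartesianProductWith f xs ys)
  cartesianProductWith-unique f {[]}          _   _            _   = []
  cartesianProductWith-unique f {x ∷ xs} {ys} inj (x≢xs ∷ xs!) ys! =
    Unique.++⁺ (map-unique (λ y∈ z∈ → proj₂ ∘ inj (here refl) (here refl) y∈ z∈) ys!)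
               (cartesianProductWith-unique f (λ w∈ x∈ → inj (there w∈) (there x∈)) xs! ys!)
               disjoint
    where
    disjoint : Disjoint (map (f x) ys) (cartesianProductWith f xs ys)
    disjoint (v∈map , v∈prod) with ∈-map⁻ (f x) v∈map | ∈-cartesianProductWith⁻ f xs ys v∈prod
    ... | y , y∈ , refl | w , z , w∈ , z∈ , fxy≡fwz =
      All.lookup x≢xs w∈ (proj₁ (inj (here refl) (there w∈) y∈ z∈ fxy≡fwz))

  length-cartesianProductWith : ∀ (f : A → B → C) xs ys →
                                length (cartesianProductWith f xs ys) ≡ length xs * length ys
  length-cartesianProductWith f []       ys = refl
  length-cartesianProductWith f (x ∷ xs) ys = begin
    length (map (f x) ys ++ cartesianProductWith f xs ys)
      ≡⟨ length-++ (map (f x) ys) ⟩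
    length (map (f x) ys) + length (cartesianProductWith f xs ys)
      ≡⟨ cong₂ _+_ (length-map (f x) ys) (length-cartesianProductWith f xs ys) ⟩
    length ys + length xs * length ys
      ∎
    where open ≡-Reasoning

-- Symmetric products and powers

parity-isOdd : ∀ n → parity n ≡ (if isOdd n then 1ℙ else 0ℙ)
parity-isOdd 0             = refl
parity-isOdd 1             = refl
parity-isOdd (suc (suc n)) = trans (parity-isOdd n) (cong (λ r → if r ≡ᵇ 1 then 1ℙ else 0ℙ) n%2≡[2+n]%2)
  where
  n%2≡[2+n]%2 : n % 2 ≡ (2 + n) % 2
  n%2≡[2+n]%2 = sym (trans (cong (_% 2) (+-comm 2 n)) ([m+n]%n≡m%n n 2))

oddIn? : ∀ zs → Decidable (λ m → T (isOdd (count m zs)))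
oddIn? zs m = T? (isOdd (count m zs))

∈-∇⁻ : ∀ {m} xs ys → m ∈ xs ∇ ys → m ∈ products xs ys × T (isOdd (count m (products xs ys)))
∈-∇⁻ xs ys m∈ =
  let m∈dedup , odd = ∈-filter⁻ (oddIn? (products xs ys)) {xs = deduplicate _≟_ (products xs ys)} m∈
  in ∈-deduplicate⁻ _≟_ (products xs ys) m∈dedup , odd

∈-∇⁺ : ∀ {m} xs ys → m ∈ products xs ys → T (isOdd (count m (products xs ys))) → m ∈ xs ∇ ys
∈-∇⁺ xs ys m∈ = ∈-filter⁺ (oddIn? (products xs ys)) (∈-deduplicate⁺ _≟_ m∈)

∇-unique : ∀ xs ys → Unique (xs ∇ ys)
∇-unique xs ys = Unique.filter⁺ (oddIn? (products xs ys)) (deduplicate-! (products xs ys))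

∇^-unique : ∀ xs n → Unique (xs ∇^ n)
∇^-unique xs zero    = [] ∷ []
∇^-unique xs (suc n) = ∇-unique (xs ∇^ n) xs

∇≈₂products : ∀ xs ys → xs ∇ ys ≈₂ products xs ys
∇≈₂products xs ys = mk≈₂ χ-∇
  where
  χ-∇ : ∀ m → χ (xs ∇ ys) m ≡ χ (products xs ys) m
  χ-∇ m with isOdd (count m (products xs ys)) in odd | parity-isOdd (count m (products xs ys))
  ... | true  | χ≡1ℙ = trans (cong parity (∈⇒count≡1 (∇-unique xs ys) m∈)) (sym χ≡1ℙ)
    where m∈ = ∈-∇⁺ xs ys (χ≡1ℙ⇒∈ (products xs ys) χ≡1ℙ) (subst T (sym odd) tt)
  ... | false | χ≡0ℙ = trans (cong parity (∉⇒count≡0 (xs ∇ ys) m∉)) (sym χ≡0ℙ)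
    where m∉ = λ m∈ → subst T odd (proj₂ (∈-∇⁻ xs ys m∈))

infixl 8 _⊗^_
_⊗^_ : List ℕ → ℕ → List ℕ
xs ⊗^ zero  = [ 1 ]
xs ⊗^ suc n = products (xs ⊗^ n) xs

∇^≈₂⊗^ : ∀ xs n → xs ∇^ n ≈₂ xs ⊗^ n
∇^≈₂⊗^ xs zero    = ≈₂-refl
∇^≈₂⊗^ xs (suc n) = ≈₂-trans (∇≈₂products (xs ∇^ n) xs) (products-≈₂ˡ xs (∇^≈₂⊗^ xs n))

⊗^-+ : ∀ xs m n → xs ⊗^ (m + n) ≡ products (xs ⊗^ m) (xs ⊗^ n)
⊗^-+ xs m zero    = trans (cong (xs ⊗^_) (+-identityʳ m)) (sym (products-identityʳ (xs ⊗^ m)))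
⊗^-+ xs m (suc n) = begin
  xs ⊗^ (m + suc n)                            ≡⟨ cong (xs ⊗^_) (+-suc m n) ⟩
  products (xs ⊗^ (m + n)) xs                  ≡⟨ cong (λ ys → products ys xs) (⊗^-+ xs m n) ⟩
  products (products (xs ⊗^ m) (xs ⊗^ n)) xs   ≡⟨ products-assoc (xs ⊗^ m) (xs ⊗^ n) xs ⟩
  products (xs ⊗^ m) (xs ⊗^ suc n)             ∎
  where open ≡-Reasoning

⊗^-*2^ : ∀ xs n j → xs ⊗^ (n * 2 ^ j) ≈₂ map (_^ 2 ^ j) (xs ⊗^ n)
⊗^-*2^ xs n zero = begin
  xs ⊗^ (n * 1)          ≡⟨ cong (xs ⊗^_) (*-identityʳ n) ⟩
  xs ⊗^ n                ≡⟨ map-id (xs ⊗^ n) ⟨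
  map id (xs ⊗^ n)       ≡⟨ map-cong (λ x → sym (*-identityʳ x)) (xs ⊗^ n) ⟩
  map (_^ 1) (xs ⊗^ n)   ∎
  where open ≈₂-Reasoning
⊗^-*2^ xs n (suc j) = begin
  xs ⊗^ (n * 2 ^ suc j)               ≡⟨ cong (xs ⊗^_) n*2^[1+j]≡c+c ⟩
  xs ⊗^ (c + c)                       ≡⟨ ⊗^-+ xs c c ⟩
  products (xs ⊗^ c) (xs ⊗^ c)        ≈⟨ products-self-≈₂ (xs ⊗^ c) ⟩
  map square (xs ⊗^ c)                ≈⟨ map-≈₂ square (⊗^-*2^ xs n j) ⟩
  map square (map (_^ e) (xs ⊗^ n))   ≡⟨ map-∘ (xs ⊗^ n) ⟨
  map (square ∘ (_^ e)) (xs ⊗^ n)     ≡⟨ map-cong x^e*x^e≡x^[2e] (xs ⊗^ n) ⟩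
  map (_^ 2 ^ suc j) (xs ⊗^ n)        ∎
  where
  open ≈₂-Reasoning
  e = 2 ^ j
  c = n * e
  square : ℕ → ℕ
  square x = x * x
  2e≡e+e : 2 ^ suc j ≡ e + e
  2e≡e+e = cong (e +_) (+-identityʳ e)
  n*2^[1+j]≡c+c : n * 2 ^ suc j ≡ c + c
  n*2^[1+j]≡c+c = trans (cong (n *_) 2e≡e+e) (*-distribˡ-+ n e e)
  x^e*x^e≡x^[2e] : ∀ x → x ^ e * x ^ e ≡ x ^ 2 ^ suc j
  x^e*x^e≡x^[2e] x = trans (sym (^-distribˡ-+-* x e e)) (cong (x ^_) (sym 2e≡e+e))

∇^-+-*2^ : ∀ xs m n j → xs ∇^ (m + n * 2 ^ j) ≈₂ products (xs ∇^ m) (map (_^ 2 ^ j) (xs ∇^ n))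
∇^-+-*2^ xs m n j = begin
  xs ∇^ (m + n * 2 ^ j)                           ≈⟨ ∇^≈₂⊗^ xs (m + n * 2 ^ j) ⟩
  xs ⊗^ (m + n * 2 ^ j)                           ≡⟨ ⊗^-+ xs m (n * 2 ^ j) ⟩
  products (xs ⊗^ m) (xs ⊗^ (n * 2 ^ j))          ≈⟨ products-≈₂ʳ (xs ⊗^ m) (⊗^-*2^ xs n j) ⟩
  products (xs ⊗^ m) (map (_^ 2 ^ j) (xs ⊗^ n))   ≈⟨ products-≈₂ˡ _ (≈₂-sym (∇^≈₂⊗^ xs m)) ⟩
  products (xs ∇^ m) (map (_^ 2 ^ j) (xs ⊗^ n))   ≈⟨ products-≈₂ʳ (xs ∇^ m)
                                                        (map-≈₂ (_^ 2 ^ j) (≈₂-sym (∇^≈₂⊗^ xs n))) ⟩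
  products (xs ∇^ m) (map (_^ 2 ^ j) (xs ∇^ n))   ∎
  where open ≈₂-Reasoning

-- Factorisation over distinct primes

infix 8 _^ᵛ_
_^ᵛ_ : ∀ {n} → Vec ℕ n → Vec ℕ n → ℕ
[]       ^ᵛ []       = 1
(p ∷ ps) ^ᵛ (e ∷ es) = p ^ e * ps ^ᵛ es

^-distribʳ-* : ∀ m n o → (m * n) ^ o ≡ m ^ o * n ^ o
^-distribʳ-* m n zero    = refl
^-distribʳ-* m n (suc o) =
  trans (cong (m * n *_) (^-distribʳ-* m n o)) ([m*n]*[o*p]≡[m*o]*[n*p] m n (m ^ o) (n ^ o))

^ᵛ-+ : ∀ {n} (ps es fs : Vec ℕ n) → ps ^ᵛ Vec.zipWith _+_ es fs ≡ ps ^ᵛ es * ps ^ᵛ fs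
^ᵛ-+ []       []       []       = refl
^ᵛ-+ (p ∷ ps) (e ∷ es) (f ∷ fs) = begin
  p ^ (e + f) * ps ^ᵛ Vec.zipWith _+_ es fs   ≡⟨ cong₂ _*_ (^-distribˡ-+-* p e f) (^ᵛ-+ ps es fs) ⟩
  (p ^ e * p ^ f) * (ps ^ᵛ es * ps ^ᵛ fs)     ≡⟨ [m*n]*[o*p]≡[m*o]*[n*p] (p ^ e) (p ^ f) _ _ ⟩
  (p ^ e * ps ^ᵛ es) * (p ^ f * ps ^ᵛ fs)     ∎
  where open ≡-Reasoning

^ᵛ-digits : ∀ {n} N (ps es fs : Vec ℕ n) →
            ps ^ᵛ es * (ps ^ᵛ fs) ^ N ≡ ps ^ᵛ Vec.zipWith (λ e f → e + f * N) es fs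
^ᵛ-digits N []       []       []       = trans (*-identityˡ (1 ^ N)) (^-zeroˡ N)
^ᵛ-digits N (p ∷ ps) (e ∷ es) (f ∷ fs) = begin
  (p ^ e * P) * (p ^ f * Q) ^ N
    ≡⟨ cong ((p ^ e * P) *_) (^-distribʳ-* (p ^ f) Q N) ⟩
  (p ^ e * P) * ((p ^ f) ^ N * Q ^ N)
    ≡⟨ cong (λ x → (p ^ e * P) * (x * Q ^ N)) (^-*-assoc p f N) ⟩
  (p ^ e * P) * (p ^ (f * N) * Q ^ N)
    ≡⟨ [m*n]*[o*p]≡[m*o]*[n*p] (p ^ e) P (p ^ (f * N)) (Q ^ N) ⟩
  (p ^ e * p ^ (f * N)) * (P * Q ^ N)
    ≡⟨ cong₂ _*_ (sym (^-distribˡ-+-* p e (f * N))) (^ᵛ-digits N ps es fs) ⟩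
  p ^ (e + f * N) * ps ^ᵛ Vec.zipWith (λ e f → e + f * N) es fs
    ∎
  where
  open ≡-Reasoning
  P = ps ^ᵛ es
  Q = ps ^ᵛ fs

prime∤1 : ∀ {p} → Prime p → ¬ p ∣ 1
prime∤1 p-prime p∣1 = ¬prime[1] (subst Prime (∣1⇒≡1 p∣1) p-prime)

prime∤* : ∀ {p m n} → Prime p → ¬ p ∣ m → ¬ p ∣ n → ¬ p ∣ m * n
prime∤* {m = m} {n} p-prime p∤m p∤n = [ p∤m , p∤n ]′ ∘ euclidsLemma m n p-prime

prime∤^ : ∀ {p m} → Prime p → ¬ p ∣ m → ∀ e → ¬ p ∣ m ^ e
prime∤^ p-prime p∤m zero    = prime∤1 p-prime
prime∤^ p-prime p∤m (suc e) = prime∤* p-prime p∤m (prime∤^ p-prime p∤m e)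

prime∤^ᵛ : ∀ {p n} {qs : Vec ℕ n} → Prime p → VecAll.All (λ q → ¬ p ∣ q) qs → ∀ es → ¬ p ∣ qs ^ᵛ es
prime∤^ᵛ p-prime []           []       = prime∤1 p-prime
prime∤^ᵛ p-prime (p∤q ∷ p∤qs) (e ∷ es) =
  prime∤* p-prime (prime∤^ p-prime p∤q e) (prime∤^ᵛ p-prime p∤qs es)

m∣m^[1+n]*o : ∀ m n o → m ∣ m ^ suc n * o
m∣m^[1+n]*o m n o = divides (m ^ n * o) (trans (*-assoc m (m ^ n) o) (*-comm m (m ^ n * o)))

prime-power-cancel : ∀ {p u v} a b → Prime p → ¬ p ∣ u → ¬ p ∣ v → p ^ a * u ≡ p ^ b * v → a ≡ b × u ≡ v
prime-power-cancel {p} {u} {v} zero zero _ _ _ eq =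
  refl , trans (sym (*-identityˡ u)) (trans eq (*-identityˡ v))
prime-power-cancel {p} {u} {v} zero (suc b) _ p∤u _ eq =
  contradiction (subst (p ∣_) (trans (sym eq) (*-identityˡ u)) (m∣m^[1+n]*o p b v)) p∤u
prime-power-cancel {p} {u} {v} (suc a) zero _ _ p∤v eq =
  contradiction (subst (p ∣_) (trans eq (*-identityˡ v)) (m∣m^[1+n]*o p a u)) p∤v
prime-power-cancel {p} {u} {v} (suc a) (suc b) p-prime p∤u p∤v eq =
  let a≡b , u≡v = prime-power-cancel a b p-prime p∤u p∤v
                    (*-cancelˡ-≡ (p ^ a * u) (p ^ b * v) p {{prime⇒nonZero p-prime}}
                      (trans (sym (*-assoc p (p ^ a) u)) (trans eq (*-assoc p (p ^ b) v))))
  in cong suc a≡b , u≡v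

^ᵛ-injective : ∀ {n} {ps : Vec ℕ n} → VecAll.All Prime ps → AllPairs (λ p q → ¬ p ∣ q) ps →
               ∀ {es fs} → ps ^ᵛ es ≡ ps ^ᵛ fs → es ≡ fs
^ᵛ-injective []                   []                      {[]}     {[]}     _  = refl
^ᵛ-injective (p-prime ∷ ps-prime) (p∤ps ∷ ps-nondividing) {e ∷ es} {f ∷ fs} eq =
  let e≡f , rest≡ = prime-power-cancel e f p-prime (prime∤^ᵛ p-prime p∤ps es) (prime∤^ᵛ p-prime p∤ps fs) eq
  in cong₂ _∷_ e≡f (^ᵛ-injective ps-prime ps-nondividing rest≡)

+-*-injective : ∀ {N e e′ f f′} → e < N → e′ < N → e + f * N ≡ e′ + f′ * N → e ≡ e′ × f ≡ f′
+-*-injective {N@(suc _)} {e} {e′} {f} {f′} e<N e′<N eq =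
  e≡e′ , *-cancelʳ-≡ f f′ N (+-cancelˡ-≡ e _ _ (trans eq (cong (_+ f′ * N) (sym e≡e′))))
  where
  open ≡-Reasoning
  e≡e′ : e ≡ e′
  e≡e′ = begin
    e                   ≡⟨ m<n⇒m%n≡m e<N ⟨
    e % N               ≡⟨ [m+kn]%n≡m%n e f N ⟨
    (e + f * N) % N     ≡⟨ cong (_% N) eq ⟩
    (e′ + f′ * N) % N   ≡⟨ [m+kn]%n≡m%n e′ f′ N ⟩
    e′ % N              ≡⟨ m<n⇒m%n≡m e′<N ⟩
    e′                  ∎

digits-injective : ∀ {n N} {es es′ fs fs′ : Vec ℕ n} → VecAll.All (_< N) es → VecAll.All (_< N) es′ →
                   Vec.zipWith (λ e f → e + f * N) es fs ≡ Vec.zipWith (λ e f → e + f * N) es′ fs′ →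
                   es ≡ es′ × fs ≡ fs′
digits-injective {es = []}    {[]}    {[]}    {[]}    []           []             _  = refl , refl
digits-injective {es = _ ∷ _} {_ ∷ _} {_ ∷ _} {_ ∷ _} (e<N ∷ es<N) (e′<N ∷ es′<N) eq =
  let head≡ , tail≡     = Vec.∷-injective eq
      e≡e′ , f≡f′       = +-*-injective e<N e′<N head≡
      es≡es′ , fs≡fs′   = digits-injective es<N es′<N tail≡
  in cong₂ _∷_ e≡e′ es≡es′ , cong₂ _∷_ f≡f′ fs≡fs′

-- 7-smooth numbers

smallPrimes : Vec ℕ 4
smallPrimes = 2 ∷ 3 ∷ 5 ∷ 7 ∷ []

Smooth : ℕ → ℕ → Set
Smooth B x = ∃ λ (es : Vec ℕ 4) → VecAll.All (_≤ B) es × x ≡ smallPrimes ^ᵛ es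

smooth-exponents : ∀ {B} es → {True (VecAll.all? (_≤? B) es)} → Smooth B (smallPrimes ^ᵛ es)
smooth-exponents es {es≤B} = es , toWitness es≤B , refl

smooth-≤7 : ∀ {d} → 1 ≤ d → d ≤ 7 → Smooth 2 d
smooth-≤7 {1} _ _ = smooth-exponents (0 ∷ 0 ∷ 0 ∷ 0 ∷ [])
smooth-≤7 {2} _ _ = smooth-exponents (1 ∷ 0 ∷ 0 ∷ 0 ∷ [])
smooth-≤7 {3} _ _ = smooth-exponents (0 ∷ 1 ∷ 0 ∷ 0 ∷ [])
smooth-≤7 {4} _ _ = smooth-exponents (2 ∷ 0 ∷ 0 ∷ 0 ∷ [])
smooth-≤7 {5} _ _ = smooth-exponents (0 ∷ 0 ∷ 1 ∷ 0 ∷ [])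
smooth-≤7 {6} _ _ = smooth-exponents (1 ∷ 1 ∷ 0 ∷ 0 ∷ [])
smooth-≤7 {7} _ _ = smooth-exponents (0 ∷ 0 ∷ 0 ∷ 1 ∷ [])
smooth-≤7 {0} ()
smooth-≤7 {suc (suc (suc (suc (suc (suc (suc (suc _)))))))} _ (s≤s (s≤s (s≤s (s≤s (s≤s (s≤s (s≤s ())))))))

smooth-* : ∀ {B C x y} → Smooth B x → Smooth C y → Smooth (B + C) (x * y)
smooth-* (es , es≤B , refl) (fs , fs≤C , refl) =
  Vec.zipWith _+_ es fs , VecAll.zipWith +-mono-≤ es≤B fs≤C , sym (^ᵛ-+ smallPrimes es fs)

-- The exponent vector of a·b^N is e + f·N with digits e ≤ B < N, so it determines e and f.
smooth-injective : ∀ {B C C′ N a a′ b b′} → B < N →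
                   Smooth B a → Smooth B a′ → Smooth C b → Smooth C′ b′ →
                   a * b ^ N ≡ a′ * b′ ^ N → a ≡ a′ × b ≡ b′
smooth-injective {B} {N = N} B<N (es , es≤B , refl) (es′ , es′≤B , refl) (fs , _ , refl) (fs′ , _ , refl) eq =
  cong (smallPrimes ^ᵛ_) es≡es′ , cong (smallPrimes ^ᵛ_) fs≡fs′
  where
  below : ∀ {xs : Vec ℕ 4} → VecAll.All (_≤ B) xs → VecAll.All (_< N) xs
  below = VecAll.map (λ x≤B → ≤-<-trans x≤B B<N)
  digits≡ : Vec.zipWith (λ e f → e + f * N) es fs ≡ Vec.zipWith (λ e f → e + f * N) es′ fs′
  digits≡ = ^ᵛ-injective (from-yes (VecAll.all? prime? smallPrimes))
                         (from-yes (allPairs? (λ p q → ¬? (p ∣? q)) smallPrimes))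
                         (trans (sym (^ᵛ-digits N smallPrimes es fs))
                                (trans eq (^ᵛ-digits N smallPrimes es′ fs′)))
  es≡es′,fs≡fs′ = digits-injective (below es≤B) (below es′≤B) digits≡
  es≡es′ = proj₁ es≡es′,fs≡fs′
  fs≡fs′ = proj₂ es≡es′,fs≡fs′

smooth-unique : ∀ {B C N xs ys} → B < N → All (Smooth B) xs → All (Smooth C) ys →
                Unique xs → Unique ys → Unique (cartesianProductWith (λ a b → a * b ^ N) xs ys)
smooth-unique B<N xs-smooth ys-smooth =
  cartesianProductWith-unique _ λ a∈ a′∈ b∈ b′∈ →
    smooth-injective B<N (All.lookup xs-smooth a∈) (All.lookup xs-smooth a′∈)
                         (All.lookup ys-smooth b∈) (All.lookup ys-smooth b′∈)

∈-H : ∀ k {d} → d ∈ H k → 1 ≤ d × d ≤ k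
∈-H (suc k) d∈ with ∈-++⁻ (H k) d∈
... | inj₁ d∈H         = let 1≤d , d≤k = ∈-H k d∈H in 1≤d , m≤n⇒m≤1+n d≤k
... | inj₂ (here refl) = s≤s z≤n , ≤-refl

H∇^-smooth : ∀ {k} → k ≤ 7 → ∀ t → All (Smooth (t * 2)) (H k ∇^ t)
H∇^-smooth     k≤7 zero    = smooth-exponents (0 ∷ 0 ∷ 0 ∷ 0 ∷ []) ∷ []
H∇^-smooth {k} k≤7 (suc t) = All.tabulate λ x∈ →
  let c , d , c∈ , d∈ , x≡cd = ∈-products⁻ (H k ∇^ t) (H k) (proj₁ (∈-∇⁻ (H k ∇^ t) (H k) x∈))
      1≤d , d≤k = ∈-H k d∈
  in subst₂ Smooth (+-comm (t * 2) 2) (sym x≡cd)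
       (smooth-* (All.lookup (H∇^-smooth k≤7 t) c∈) (smooth-≤7 1≤d (≤-trans d≤k k≤7)))

lemma1 : (k α β s : ℕ) → 1 ≤ k → k ≤ 7 → 1 ≤ α → 1 ≤ β → 1 ≤ s → α < 2 ^ s →
    ∣ H k ∇^ (α + β * 2 ^ (s + 1)) ∣ ≡ ∣ H k ∇^ α ∣ * ∣ H k ∇^ β ∣
lemma1 k α β s _ k≤7 _ _ _ α<2^s = begin
  ∣ Hⁿ ∣                                ≡⟨ unique-≈₂⇒length≡ (∇^-unique (H k) n) product-unique Hⁿ≈₂product ⟩
  length (cartesianProductWith f Hᵅ Hᵝ)  ≡⟨ length-cartesianProductWith f Hᵅ Hᵝ ⟩
  ∣ Hᵅ ∣ * ∣ Hᵝ ∣                        ∎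
  where
  open ≡-Reasoning
  N  = 2 ^ (s + 1)
  n  = α + β * N
  Hⁿ = H k ∇^ n
  Hᵅ = H k ∇^ α
  Hᵝ = H k ∇^ β
  f  = λ a b → a * b ^ N
  Hⁿ≈₂product : Hⁿ ≈₂ cartesianProductWith f Hᵅ Hᵝ
  Hⁿ≈₂product = subst (Hⁿ ≈₂_) (products-map≡cartesianProductWith (_^ N) Hᵅ Hᵝ) (∇^-+-*2^ (H k) α β (s + 1))
  α*2<N : α * 2 < N
  α*2<N = subst (α * 2 <_) (sym (^-distribˡ-+-* 2 s 1)) (*-monoˡ-< 2 α<2^s)
  product-unique : Unique (cartesianProductWith f Hᵅ Hᵝ)
  product-unique = smooth-unique α*2<N (H∇^-smooth k≤7 α) (H∇^-smooth k≤7 β)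
                                       (∇^-unique (H k) α) (∇^-unique (H k) β)
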